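{- Let $\Gamma=\langle\rho_0,\rho_1,\rho_2\rangle$ be an sggi with $\sigma_1=\rho_0\rho_1$ and $\sigma_2=\rho_1\rho_2$, and let $i,j$ be integers. (a) If $\sigma_2^{ -1}\sigma_1=\sigma_1^i\sigma_2^j$, then each of $\sigma_1^{i+1}$ and $\sigma_2^{j-1}$ is inverted under conjugation by $\rho_0$, by $\rho_1$ and by $\rho_2$; in particular $\langle\sigma_1^{i+1}\rangle$ and $\langle\sigma_2^{j-1}\rangle$ are normal subgroups of $\Gamma$. (b) If $\sigma_2^{ -1}\sigma_1=\sigma_1^i\rho_1\sigma_2^j$, then $\sigma_1^{i-2}$ is inverted under conjugation by $\rho_0$, by $\rho_1$ and by $\sigma_2$, and commutes with $\rho_2$; and $\sigma_2^{j+2}$ is inverted under conjugation by $\rho_1$, by $\rho_2$ and by $\sigma_1$, and commutes with $\rho_0$. In particular $\langle\sigma_1^{i-2}\rangle$ and $\langle\sigma_2^{j+2}\rangle$ are normal subgroups of $\Gamma$.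
   Context: An sggi (string group generated by involutions) of rank 3 is a group $\Gamma=\langle\rho_0,\rho_1,\rho_2\rangle$ with distinguished generators each of order 2 satisfying $(\rho_0\rho_2)^2=1$. -}

module Defs where

open import Level using (Level; _⊔_)
open import Algebra.Bundles using (Group)
open import Data.Nat using (ℕ; zero; suc)
open import Data.Integer using (ℤ; +_; -[1+_]; _+_; _-_; 1ℤ)
open import Data.Fin using (Fin; zero; suc)
open import Data.List using (List; []; _∷_)
open import Data.Product using (∃; _×_)
open import Relation.Nullary using (¬_)

module GroupNotions {c ℓ : Level} (G : Group c ℓ) where
  open Group G

  powℕ : Carrier → ℕ → Carrier
  powℕ x zero    = ε
  powℕ x (suc n) = x ∙ powℕ x n

  _^_ : Carrier → ℤ → Carrier
  x ^ (+ n)      = powℕ x n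
  x ^ (-[1+ n ]) = (powℕ x (suc n)) ⁻¹

  InvertedBy : Carrier → Carrier → Set ℓ
  InvertedBy x g = (g ⁻¹ ∙ x) ∙ g ≈ x ⁻¹

  CommutesWith : Carrier → Carrier → Set ℓ
  CommutesWith x g = x ∙ g ≈ g ∙ x

  HasOrder2 : Carrier → Set ℓ
  HasOrder2 g = (¬ (g ≈ ε)) × (g ∙ g ≈ ε)

  -- evaluation of a word in three given generators (involutions, so no inverses needed)
  evalWord : Carrier → Carrier → Carrier → List (Fin 3) → Carrier
  evalWord a b d []                        = ε
  evalWord a b d (zero ∷ w)                = a ∙ evalWord a b d w
  evalWord a b d (suc zero ∷ w)            = b ∙ evalWord a b d w
  evalWord a b d (suc (suc zero) ∷ w)      = d ∙ evalWord a b d w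

  CyclicNormal : Carrier → Set (c ⊔ ℓ)
  CyclicNormal x = ∀ (g : Carrier) (k : ℤ) → ∃ λ (m : ℤ) → (g ⁻¹ ∙ (x ^ k)) ∙ g ≈ x ^ m

record SGGI3 {c ℓ : Level} (G : Group c ℓ) : Set (c ⊔ ℓ) where
  open Group G
  open GroupNotions G
  field
    ρ₀ ρ₁ ρ₂ : Carrier
    ρ₀-order2 : HasOrder2 ρ₀
    ρ₁-order2 : HasOrder2 ρ₁
    ρ₂-order2 : HasOrder2 ρ₂
    ρ₀ρ₂-sq   : (ρ₀ ∙ ρ₂) ∙ (ρ₀ ∙ ρ₂) ≈ ε

  field
    generated : ∀ (g : Carrier) → ∃ λ (w : List (Fin 3)) → evalWord ρ₀ ρ₁ ρ₂ w ≈ g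

  σ₁ σ₂ : Carrier
  σ₁ = ρ₀ ∙ ρ₁
  σ₂ = ρ₁ ∙ ρ₂

-- Write P = σ₁ ^ i and Q = σ₂ ^ j. Conjugation by ρ₁ is an automorphism inverting σ₁ and σ₂, hence
-- all their powers; ρ₀ inverts σ₁ and ρ₂ inverts σ₂.
-- (a) Conjugating σ₂⁻¹σ₁ = PQ by ρ₁ and inverting gives σ₁σ₂⁻¹ = QP. Two factorisations xy = uv and
-- yx = vu with uy = yu force uy to commute with x, so σ₁^(i+1) = Pσ₁ commutes with σ₂ and, with the
-- roles swapped, σ₂^(j-1) = Qσ₂⁻¹ commutes with σ₁. Since ρ₂ = ρ₁σ₂ and ρ₀ = σ₁ρ₁, both powers are
-- then inverted by every generator.
-- (b) Now σ₂⁻¹σ₁ = Pr with r = ρ₁Q an involution, and (σ₁σ₂)² = (ρ₀ρ₂)² = 1 gives σ₁σ₂σ₁ = σ₂⁻¹;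
-- comparing r with r⁻¹ shows that σ₂ inverts Pσ₁⁻² = σ₁^(i-2). Inverting the hypothesis gives
-- σ₁⁻¹σ₂ = Q⁻¹(ρ₁P⁻¹), the same shape with σ₁ and σ₂ exchanged, so σ₁ inverts σ₂^(j+2). An element
-- inverted by g and by h commutes with gh, which yields the commutations with ρ₂ = ρ₁σ₂ and ρ₀ = σ₁ρ₁.
-- In every case each generator conjugates the element to itself or its inverse, so its cyclic
-- subgroup is normal.

module Submission where

open import Defs
open import Level using (Level)
open import Algebra.Bundles using (Group)
open import Data.Nat using (zero; suc)
open import Data.Integer using (ℤ; +_; -[1+_]; _+_; _-_; 1ℤ; -_)
import Data.Integer.Properties as ℤ
import Data.Nat.Properties as ℕ
open import Data.Fin using (zero; suc)
open import Data.List using (_∷_; [])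
open import Data.Product using (_×_; _,_; ∃; proj₂)
open import Relation.Binary.PropositionalEquality as ≡ using (cong)

module Conjugation {c ℓ : Level} (G : Group c ℓ) where
  open Group G hiding (_-_)
  open GroupNotions G
  open import Algebra.Properties.Group G
  open import Algebra.Properties.Monoid monoid using (insertˡ; insertʳ; cancelˡ; elimˡ)
  open import Algebra.Solver.Monoid monoid using (solve; _⊜_; _⊕_)
  open import Relation.Binary.Reasoning.Setoid setoid

  conj : Carrier → Carrier → Carrier
  conj g x = (g ⁻¹ ∙ x) ∙ g

  conj-congʳ : ∀ g {x y} → x ≈ y → conj g x ≈ conj g y
  conj-congʳ g x≈y = ∙-congʳ (∙-congˡ x≈y)

  conj-congˡ : ∀ {g h} x → g ≈ h → conj g x ≈ conj h x
  conj-congˡ x g≈h = ∙-cong (∙-congʳ (⁻¹-cong g≈h)) g≈h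

  conj-ε : ∀ g → conj g ε ≈ ε
  conj-ε g = trans (∙-congʳ (identityʳ _)) (inverseˡ g)

  conj-by-ε : ∀ x → conj ε x ≈ x
  conj-by-ε x = trans (identityʳ _) (elimˡ ε⁻¹≈ε x)

  conj-∙ : ∀ g x y → conj g (x ∙ y) ≈ conj g x ∙ conj g y
  conj-∙ g x y = begin
    (g ⁻¹ ∙ (x ∙ y)) ∙ g                ≈⟨ conj-congʳ g (∙-congʳ (insertʳ (inverseʳ g) x)) ⟩
    (g ⁻¹ ∙ ((x ∙ g) ∙ g ⁻¹ ∙ y)) ∙ g   ≈⟨ solve 4 (λ g' x y g → (g' ⊕ ((((x ⊕ g) ⊕ g') ⊕ y))) ⊕ g
                                                           ⊜ ((g' ⊕ x) ⊕ g) ⊕ ((g' ⊕ y) ⊕ g))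
                                               refl (g ⁻¹) x y g ⟩
    conj g x ∙ conj g y                  ∎

  conj-⁻¹ : ∀ g x → conj g (x ⁻¹) ≈ conj g x ⁻¹
  conj-⁻¹ g x = inverseʳ-unique (conj g x) (conj g (x ⁻¹)) (begin
    conj g x ∙ conj g (x ⁻¹) ≈⟨ conj-∙ g x (x ⁻¹) ⟨
    conj g (x ∙ x ⁻¹)        ≈⟨ conj-congʳ g (inverseʳ x) ⟩
    conj g ε                 ≈⟨ conj-ε g ⟩
    ε                        ∎)

  conj-by-∙ : ∀ g h x → conj (g ∙ h) x ≈ conj h (conj g x)
  conj-by-∙ g h x = begin
    ((g ∙ h) ⁻¹ ∙ x) ∙ (g ∙ h)     ≈⟨ ∙-congʳ (∙-congʳ (⁻¹-anti-homo-∙ g h)) ⟩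
    ((h ⁻¹ ∙ g ⁻¹) ∙ x) ∙ (g ∙ h)  ≈⟨ solve 5 (λ h' g' x g h → ((h' ⊕ g') ⊕ x) ⊕ (g ⊕ h)
                                                  ⊜ (h' ⊕ ((g' ⊕ x) ⊕ g)) ⊕ h)
                                         refl (h ⁻¹) (g ⁻¹) x g h ⟩
    conj h (conj g x)              ∎

  ∙≈∙⇒conj≈ : ∀ {g x y} → x ∙ g ≈ g ∙ y → conj g x ≈ y
  ∙≈∙⇒conj≈ {g} {x} {y} xg≈gy = begin
    (g ⁻¹ ∙ x) ∙ g   ≈⟨ assoc _ _ _ ⟩
    g ⁻¹ ∙ (x ∙ g)   ≈⟨ ∙-congˡ xg≈gy ⟩
    g ⁻¹ ∙ (g ∙ y)   ≈⟨ cancelˡ (inverseˡ g) y ⟩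
    y                ∎

  conj≈⇒∙≈∙ : ∀ {g x y} → conj g x ≈ y → x ∙ g ≈ g ∙ y
  conj≈⇒∙≈∙ {g} {x} {y} conj≈y = begin
    x ∙ g                ≈⟨ insertˡ (inverseʳ g) _ ⟩
    g ∙ (g ⁻¹ ∙ (x ∙ g)) ≈⟨ ∙-congˡ (sym (assoc _ _ _)) ⟩
    g ∙ conj g x         ≈⟨ ∙-congˡ conj≈y ⟩
    g ∙ y                ∎

  CommutesWith⇒conj≈ : ∀ {x g} → CommutesWith x g → conj g x ≈ x
  CommutesWith⇒conj≈ = ∙≈∙⇒conj≈

  InvertedBy-intro : ∀ {x g} → x ∙ g ≈ g ∙ x ⁻¹ → InvertedBy x g
  InvertedBy-intro = ∙≈∙⇒conj≈

  CommutesWith-⁻¹ : ∀ {x g} → CommutesWith x g → CommutesWith x (g ⁻¹)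
  CommutesWith-⁻¹ {x} {g} xg≈gx = begin
    x ∙ g ⁻¹                    ≈⟨ insertˡ (inverseˡ g) _ ⟩
    g ⁻¹ ∙ (g ∙ (x ∙ g ⁻¹))     ≈⟨ ∙-congˡ (sym (assoc _ _ _)) ⟩
    g ⁻¹ ∙ ((g ∙ x) ∙ g ⁻¹)     ≈⟨ ∙-congˡ (∙-congʳ (sym xg≈gx)) ⟩
    g ⁻¹ ∙ ((x ∙ g) ∙ g ⁻¹)     ≈⟨ ∙-congˡ (assoc _ _ _) ⟩
    g ⁻¹ ∙ (x ∙ (g ∙ g ⁻¹))     ≈⟨ ∙-congˡ (∙-congˡ (inverseʳ g)) ⟩
    g ⁻¹ ∙ (x ∙ ε)              ≈⟨ ∙-congˡ (identityʳ x) ⟩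
    g ⁻¹ ∙ x                    ∎

  CommutesWith-respˡ : ∀ {x y g} → x ≈ y → CommutesWith x g → CommutesWith y g
  CommutesWith-respˡ x≈y xg≈gx = trans (∙-congʳ (sym x≈y)) (trans xg≈gx (∙-congˡ x≈y))

  CommutesWith-respʳ : ∀ {x g h} → g ≈ h → CommutesWith x g → CommutesWith x h
  CommutesWith-respʳ g≈h xg≈gx = trans (∙-congˡ (sym g≈h)) (trans xg≈gx (∙-congʳ g≈h))

  InvertedBy-respˡ : ∀ {x y g} → x ≈ y → InvertedBy x g → InvertedBy y g
  InvertedBy-respˡ {g = g} x≈y inv = trans (conj-congʳ g (sym x≈y)) (trans inv (⁻¹-cong x≈y))

  InvertedBy-respʳ : ∀ {x g h} → g ≈ h → InvertedBy x g → InvertedBy x h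
  InvertedBy-respʳ {x} g≈h inv = trans (conj-congˡ x (sym g≈h)) inv

  InvertedBy-⁻¹ : ∀ {x g} → InvertedBy x g → InvertedBy (x ⁻¹) g
  InvertedBy-⁻¹ {x} {g} inv = trans (conj-⁻¹ g x) (⁻¹-cong inv)

  InvertedBy-∙-CommutesWith : ∀ {x g h} → InvertedBy x g → CommutesWith x h → InvertedBy x (g ∙ h)
  InvertedBy-∙-CommutesWith {x} {g} {h} inv comm = begin
    conj (g ∙ h) x     ≈⟨ conj-by-∙ g h x ⟩
    conj h (conj g x)  ≈⟨ conj-congʳ h inv ⟩
    conj h (x ⁻¹)      ≈⟨ conj-⁻¹ h x ⟩
    conj h x ⁻¹        ≈⟨ ⁻¹-cong (CommutesWith⇒conj≈ comm) ⟩
    x ⁻¹               ∎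

  CommutesWith-∙-InvertedBy : ∀ {x g h} → CommutesWith x g → InvertedBy x h → InvertedBy x (g ∙ h)
  CommutesWith-∙-InvertedBy {x} {g} {h} comm inv =
    trans (conj-by-∙ g h x) (trans (conj-congʳ h (CommutesWith⇒conj≈ comm)) inv)

  InvertedBy-∙-InvertedBy : ∀ {x g h} → InvertedBy x g → InvertedBy x h → CommutesWith x (g ∙ h)
  InvertedBy-∙-InvertedBy {x} {g} {h} invg invh = conj≈⇒∙≈∙ (begin
    conj (g ∙ h) x     ≈⟨ conj-by-∙ g h x ⟩
    conj h (conj g x)  ≈⟨ conj-congʳ h invg ⟩
    conj h (x ⁻¹)      ≈⟨ conj-⁻¹ h x ⟩
    conj h x ⁻¹        ≈⟨ ⁻¹-cong invh ⟩
    x ⁻¹ ⁻¹            ≈⟨ ⁻¹-involutive x ⟩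
    x                  ∎)

  involution⁻¹≈ : ∀ {g} → g ∙ g ≈ ε → g ⁻¹ ≈ g
  involution⁻¹≈ {g} gg≈ε = sym (inverseˡ-unique g g gg≈ε)

  involution-∙-InvertedBy : ∀ {b x} → b ∙ b ≈ ε → InvertedBy x b → (b ∙ x) ∙ (b ∙ x) ≈ ε
  involution-∙-InvertedBy {b} {x} bb≈ε inv = begin
    (b ∙ x) ∙ (b ∙ x)    ≈⟨ sym (assoc _ _ _) ⟩
    ((b ∙ x) ∙ b) ∙ x    ≈⟨ ∙-congʳ (∙-congʳ (∙-congʳ (sym (involution⁻¹≈ bb≈ε)))) ⟩
    conj b x ∙ x         ≈⟨ ∙-congʳ inv ⟩
    x ⁻¹ ∙ x             ≈⟨ inverseˡ x ⟩
    ε                    ∎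

  involutions-∙-InvertedByˡ : ∀ {a b} → a ∙ a ≈ ε → b ∙ b ≈ ε → InvertedBy (a ∙ b) a
  involutions-∙-InvertedByˡ {a} {b} aa≈ε bb≈ε = begin
    (a ⁻¹ ∙ (a ∙ b)) ∙ a  ≈⟨ ∙-congʳ (sym (assoc _ _ _)) ⟩
    ((a ⁻¹ ∙ a) ∙ b) ∙ a  ≈⟨ ∙-congʳ (elimˡ (inverseˡ a) b) ⟩
    b ∙ a                 ≈⟨ ∙-cong (sym (involution⁻¹≈ bb≈ε)) (sym (involution⁻¹≈ aa≈ε)) ⟩
    b ⁻¹ ∙ a ⁻¹           ≈⟨ ⁻¹-anti-homo-∙ a b ⟨
    (a ∙ b) ⁻¹            ∎

  involutions-∙-InvertedByʳ : ∀ {a b} → a ∙ a ≈ ε → b ∙ b ≈ ε → InvertedBy (a ∙ b) b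
  involutions-∙-InvertedByʳ {a} {b} aa≈ε bb≈ε = begin
    (b ⁻¹ ∙ (a ∙ b)) ∙ b  ≈⟨ solve 3 (λ b' a b → (b' ⊕ (a ⊕ b)) ⊕ b ⊜ (b' ⊕ a) ⊕ (b ⊕ b)) refl (b ⁻¹) a b ⟩
    (b ⁻¹ ∙ a) ∙ (b ∙ b)  ≈⟨ ∙-cong (∙-congˡ (sym (involution⁻¹≈ aa≈ε))) bb≈ε ⟩
    (b ⁻¹ ∙ a ⁻¹) ∙ ε     ≈⟨ identityʳ _ ⟩
    b ⁻¹ ∙ a ⁻¹           ≈⟨ ⁻¹-anti-homo-∙ a b ⟨
    (a ∙ b) ⁻¹            ∎

module Powers {c ℓ : Level} (G : Group c ℓ) where
  open Group G hiding (_-_)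
  open GroupNotions G
  open Conjugation G
  open import Algebra.Properties.Group G
  open import Algebra.Properties.Monoid monoid using (insertʳ)
  open import Relation.Binary.Reasoning.Setoid setoid

  powℕ-cong : ∀ {x y} n → x ≈ y → powℕ x n ≈ powℕ y n
  powℕ-cong zero    x≈y = refl
  powℕ-cong (suc n) x≈y = ∙-cong x≈y (powℕ-cong n x≈y)

  ^-cong : ∀ {x y} k → x ≈ y → x ^ k ≈ y ^ k
  ^-cong (+ n)    x≈y = powℕ-cong n x≈y
  ^-cong -[1+ n ] x≈y = ⁻¹-cong (powℕ-cong (suc n) x≈y)

  powℕ-comm : ∀ x n → x ∙ powℕ x n ≈ powℕ x n ∙ x
  powℕ-comm x zero    = trans (identityʳ x) (sym (identityˡ x))
  powℕ-comm x (suc n) = trans (∙-congˡ (powℕ-comm x n)) (sym (assoc _ _ _))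

  ^-comm : ∀ x k → CommutesWith (x ^ k) x
  ^-comm x (+ n)    = sym (powℕ-comm x n)
  ^-comm x -[1+ n ] = sym (CommutesWith-⁻¹ (powℕ-comm x (suc n)))

  ^-suc : ∀ x k → x ^ (k + 1ℤ) ≈ x ^ k ∙ x
  ^-suc x (+ n)            = trans (reflexive (cong (powℕ x) (ℕ.+-comm n 1))) (powℕ-comm x n)
  ^-suc x -[1+ zero ]      = sym (trans (∙-congʳ (⁻¹-cong (identityʳ x))) (inverseˡ x))
  ^-suc x -[1+ suc n ]     = begin
    (x ∙ powℕ x n) ⁻¹                     ≈⟨ insertʳ (inverseˡ x) _ ⟩
    ((x ∙ powℕ x n) ⁻¹ ∙ x ⁻¹) ∙ x        ≈⟨ ∙-congʳ (⁻¹-anti-homo-∙ x _) ⟨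
    (x ∙ (x ∙ powℕ x n)) ⁻¹ ∙ x           ∎

  ^-pred : ∀ x k → x ^ (k - 1ℤ) ≈ x ^ k ∙ x ⁻¹
  ^-pred x k = x≈z//y _ x _ (begin
    x ^ (k - 1ℤ) ∙ x         ≈⟨ ^-suc x (k - 1ℤ) ⟨
    x ^ ((k - 1ℤ) + 1ℤ)      ≡⟨ cong (x ^_) (≡.trans (ℤ.+-assoc k (- 1ℤ) 1ℤ) (ℤ.+-identityʳ k)) ⟩
    x ^ k                    ∎)

  ^-neg : ∀ x k → x ^ (- k) ≈ x ^ k ⁻¹
  ^-neg x (+ zero)  = sym ε⁻¹≈ε
  ^-neg x (+ suc n) = refl
  ^-neg x -[1+ n ]  = sym (⁻¹-involutive _)

  powℕ-⁻¹ : ∀ x n → powℕ (x ⁻¹) n ≈ powℕ x n ⁻¹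
  powℕ-⁻¹ x zero    = sym ε⁻¹≈ε
  powℕ-⁻¹ x (suc n) = begin
    x ⁻¹ ∙ powℕ (x ⁻¹) n  ≈⟨ ∙-congˡ (powℕ-⁻¹ x n) ⟩
    x ⁻¹ ∙ powℕ x n ⁻¹    ≈⟨ ⁻¹-anti-homo-∙ _ x ⟨
    (powℕ x n ∙ x) ⁻¹     ≈⟨ ⁻¹-cong (powℕ-comm x n) ⟨
    (x ∙ powℕ x n) ⁻¹     ∎

  ⁻¹-^ : ∀ x k → (x ⁻¹) ^ k ≈ x ^ k ⁻¹
  ⁻¹-^ x (+ n)    = powℕ-⁻¹ x n
  ⁻¹-^ x -[1+ n ] = ⁻¹-cong (powℕ-⁻¹ x (suc n))

  conj-powℕ : ∀ g x n → conj g (powℕ x n) ≈ powℕ (conj g x) n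
  conj-powℕ g x zero    = conj-ε g
  conj-powℕ g x (suc n) = trans (conj-∙ g x _) (∙-congˡ (conj-powℕ g x n))

  conj-^ : ∀ g x k → conj g (x ^ k) ≈ conj g x ^ k
  conj-^ g x (+ n)    = conj-powℕ g x n
  conj-^ g x -[1+ n ] = trans (conj-⁻¹ g _) (⁻¹-cong (conj-powℕ g x (suc n)))

  InvertedBy-^ : ∀ {x g} k → InvertedBy x g → InvertedBy (x ^ k) g
  InvertedBy-^ {x} {g} k inv = trans (conj-^ g x k) (trans (^-cong k inv) (⁻¹-^ x k))

  ^-suc² : ∀ x k → x ^ (k + (1ℤ + 1ℤ)) ≈ (x ^ k ∙ x) ∙ x
  ^-suc² x k = trans (reflexive (cong (x ^_) (≡.sym (ℤ.+-assoc k 1ℤ 1ℤ))))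
                   (trans (^-suc x (k + 1ℤ)) (∙-congʳ (^-suc x k)))

  ^-pred² : ∀ x k → x ^ (k - (1ℤ + 1ℤ)) ≈ (x ^ k ∙ x ⁻¹) ∙ x ⁻¹
  ^-pred² x k = trans (reflexive (cong (x ^_) (≡.sym (ℤ.+-assoc k (- 1ℤ) (- 1ℤ)))))
                   (trans (^-pred x (k - 1ℤ)) (∙-congʳ (^-pred x k)))

  Normalises : Carrier → Carrier → Set _
  Normalises g x = ∀ k → ∃ λ m → conj g (x ^ k) ≈ x ^ m

  InvertedBy⇒Normalises : ∀ {x g} → InvertedBy x g → Normalises g x
  InvertedBy⇒Normalises {x} inv k = - k , trans (InvertedBy-^ k inv) (sym (^-neg x k))

  CommutesWith⇒Normalises : ∀ {x g} → CommutesWith x g → Normalises g x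
  CommutesWith⇒Normalises {x} {g} comm k = k , trans (conj-^ g x k) (^-cong k (CommutesWith⇒conj≈ comm))

  Normalises-ε : ∀ x → Normalises ε x
  Normalises-ε x k = k , conj-by-ε (x ^ k)

  Normalises-∙ : ∀ {g h x} → Normalises g x → Normalises h x → Normalises (g ∙ h) x
  Normalises-∙ {g} {h} {x} ng nh k with ng k
  ... | l , conj-g≈ with nh l
  ... | m , conj-h≈ = m , trans (conj-by-∙ g h _) (trans (conj-congʳ h conj-g≈) conj-h≈)

  Normalises-evalWord : ∀ {a b d x} → Normalises a x → Normalises b x → Normalises d x →
                        ∀ w → Normalises (evalWord a b d w) x
  Normalises-evalWord na nb nd []                        = Normalises-ε _
  Normalises-evalWord na nb nd (zero ∷ w)                = Normalises-∙ na (Normalises-evalWord na nb nd w)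
  Normalises-evalWord na nb nd (suc zero ∷ w)            = Normalises-∙ nb (Normalises-evalWord na nb nd w)
  Normalises-evalWord na nb nd (suc (suc zero) ∷ w)      = Normalises-∙ nd (Normalises-evalWord na nb nd w)

module Factorisations {c ℓ : Level} (G : Group c ℓ) where
  open Group G hiding (_-_)
  open GroupNotions G
  open Conjugation G
  open import Algebra.Properties.Group G
  open import Algebra.Solver.Monoid monoid using (solve; _⊜_; _⊕_)
  open import Relation.Binary.Reasoning.Setoid setoid

  conj-∙-InvertedBy : ∀ {g x y} → InvertedBy x g → InvertedBy y g → conj g (x ∙ y) ≈ x ⁻¹ ∙ y ⁻¹
  conj-∙-InvertedBy {g} {x} {y} invx invy = trans (conj-∙ g x y) (∙-cong invx invy)

  InvertedBy-factorisation-swap : ∀ {g x y u v} →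
    InvertedBy x g → InvertedBy y g → InvertedBy u g → InvertedBy v g →
    x ∙ y ≈ u ∙ v → y ∙ x ≈ v ∙ u
  InvertedBy-factorisation-swap {g} {x} {y} {u} {v} invx invy invu invv xy≈uv = begin
    y ∙ x                  ≈⟨ ⁻¹⁻¹∙⁻¹⁻¹ x y ⟨
    (x ⁻¹ ∙ y ⁻¹) ⁻¹       ≈⟨ ⁻¹-cong (conj-∙-InvertedBy invx invy) ⟨
    conj g (x ∙ y) ⁻¹      ≈⟨ ⁻¹-cong (conj-congʳ g xy≈uv) ⟩
    conj g (u ∙ v) ⁻¹      ≈⟨ ⁻¹-cong (conj-∙-InvertedBy invu invv) ⟩
    (u ⁻¹ ∙ v ⁻¹) ⁻¹       ≈⟨ ⁻¹⁻¹∙⁻¹⁻¹ u v ⟩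
    v ∙ u                  ∎
    where
    ⁻¹⁻¹∙⁻¹⁻¹ : ∀ a b → (a ⁻¹ ∙ b ⁻¹) ⁻¹ ≈ b ∙ a
    ⁻¹⁻¹∙⁻¹⁻¹ a b = trans (⁻¹-anti-homo-∙ _ _) (∙-cong (⁻¹-involutive b) (⁻¹-involutive a))

  factorisations⇒CommutesWith : ∀ {x y u v} → x ∙ y ≈ u ∙ v → y ∙ x ≈ v ∙ u →
                                CommutesWith u y → CommutesWith (u ∙ y) x
  factorisations⇒CommutesWith {x} {y} {u} {v} xy≈uv yx≈vu uy≈yu = begin
    (u ∙ y) ∙ x   ≈⟨ assoc u y x ⟩
    u ∙ (y ∙ x)   ≈⟨ ∙-congˡ yx≈vu ⟩
    u ∙ (v ∙ u)   ≈⟨ assoc u v u ⟨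
    (u ∙ v) ∙ u   ≈⟨ ∙-congʳ xy≈uv ⟨
    (x ∙ y) ∙ u   ≈⟨ assoc x y u ⟩
    x ∙ (y ∙ u)   ≈⟨ ∙-congˡ uy≈yu ⟨
    x ∙ (u ∙ y)   ∎

  twisted-factorisation⇒InvertedBy : ∀ {s t p r} → s ∙ (t ∙ s) ≈ t ⁻¹ → CommutesWith p (s ⁻¹) →
    r ∙ r ≈ ε → t ⁻¹ ∙ s ≈ p ∙ r → InvertedBy ((p ∙ s ⁻¹) ∙ s ⁻¹) t
  twisted-factorisation⇒InvertedBy {s} {t} {p} {r} sts≈t⁻¹ ps⁻¹≈s⁻¹p rr≈ε t⁻¹s≈pr = InvertedBy-intro (begin
    ((p ∙ s ⁻¹) ∙ s ⁻¹) ∙ t      ≈⟨ ∙-congʳ (∙-congʳ ps⁻¹≈s⁻¹p) ⟩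
    ((s ⁻¹ ∙ p) ∙ s ⁻¹) ∙ t      ≈⟨ solve 3 (λ s' p t → ((s' ⊕ p) ⊕ s') ⊕ t ⊜ s' ⊕ (p ⊕ (s' ⊕ t)))
                                         refl (s ⁻¹) p t ⟩
    s ⁻¹ ∙ (p ∙ (s ⁻¹ ∙ t))      ≈⟨ ∙-congˡ t⁻¹sp⁻¹≈ps⁻¹t ⟨
    s ⁻¹ ∙ ((t ⁻¹ ∙ s) ∙ p ⁻¹)   ≈⟨ solve 4 (λ s' t' s p' → s' ⊕ ((t' ⊕ s) ⊕ p') ⊜ (s' ⊕ t') ⊕ (s ⊕ p'))
                                         refl (s ⁻¹) (t ⁻¹) s (p ⁻¹) ⟩
    (s ⁻¹ ∙ t ⁻¹) ∙ (s ∙ p ⁻¹)   ≈⟨ ∙-congʳ ts≈s⁻¹t⁻¹ ⟨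
    (t ∙ s) ∙ (s ∙ p ⁻¹)         ≈⟨ assoc t s _ ⟩
    t ∙ (s ∙ (s ∙ p ⁻¹))         ≈⟨ ∙-congˡ ps⁻¹s⁻¹-⁻¹ ⟨
    t ∙ ((p ∙ s ⁻¹) ∙ s ⁻¹) ⁻¹   ∎)
    where
    t⁻¹sp⁻¹≈ps⁻¹t : (t ⁻¹ ∙ s) ∙ p ⁻¹ ≈ p ∙ (s ⁻¹ ∙ t)
    t⁻¹sp⁻¹≈ps⁻¹t = begin
      (t ⁻¹ ∙ s) ∙ p ⁻¹   ≈⟨ ∙-congʳ t⁻¹s≈pr ⟩
      (p ∙ r) ∙ p ⁻¹      ≈⟨ assoc p r _ ⟩
      p ∙ (r ∙ p ⁻¹)      ≈⟨ ∙-congˡ (∙-congʳ (involution⁻¹≈ rr≈ε)) ⟨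
      p ∙ (r ⁻¹ ∙ p ⁻¹)   ≈⟨ ∙-congˡ (⁻¹-anti-homo-∙ p r) ⟨
      p ∙ (p ∙ r) ⁻¹      ≈⟨ ∙-congˡ (⁻¹-cong t⁻¹s≈pr) ⟨
      p ∙ (t ⁻¹ ∙ s) ⁻¹   ≈⟨ ∙-congˡ (⁻¹-anti-homo-\\ t s) ⟩
      p ∙ (s ⁻¹ ∙ t)      ∎
    ts≈s⁻¹t⁻¹ : t ∙ s ≈ s ⁻¹ ∙ t ⁻¹
    ts≈s⁻¹t⁻¹ = y≈x\\z s (t ∙ s) (t ⁻¹) sts≈t⁻¹
    ps⁻¹s⁻¹-⁻¹ : ((p ∙ s ⁻¹) ∙ s ⁻¹) ⁻¹ ≈ s ∙ (s ∙ p ⁻¹)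
    ps⁻¹s⁻¹-⁻¹ = trans (⁻¹-anti-homo-// (p ∙ s ⁻¹) s) (∙-congˡ (⁻¹-anti-homo-// p s))

  ∙-involution⇒sts≈t⁻¹ : ∀ {s t} → (s ∙ t) ∙ (s ∙ t) ≈ ε → s ∙ (t ∙ s) ≈ t ⁻¹
  ∙-involution⇒sts≈t⁻¹ {s} {t} stst≈ε = inverseˡ-unique (s ∙ (t ∙ s)) t (trans
    (solve 2 (λ s t → (s ⊕ (t ⊕ s)) ⊕ t ⊜ (s ⊕ t) ⊕ (s ⊕ t)) refl s t) stst≈ε)

  ∙-involution⇒tst≈s⁻¹ : ∀ {s t} → (s ∙ t) ∙ (s ∙ t) ≈ ε → t ∙ (s ∙ t) ≈ s ⁻¹
  ∙-involution⇒tst≈s⁻¹ {s} {t} stst≈ε = inverseʳ-unique s (t ∙ (s ∙ t)) (trans (sym (assoc s t _)) stst≈ε)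

module SGGI3-Properties {c ℓ : Level} {G : Group c ℓ} (Γ : SGGI3 G) where
  open Group G hiding (_-_)
  open GroupNotions G
  open Conjugation G
  open Powers G
  open Factorisations G
  open SGGI3 Γ
  open import Algebra.Properties.Group G
  open import Relation.Binary.Reasoning.Setoid setoid

  ρ₀²≈ε : ρ₀ ∙ ρ₀ ≈ ε
  ρ₀²≈ε = proj₂ ρ₀-order2

  ρ₁²≈ε : ρ₁ ∙ ρ₁ ≈ ε
  ρ₁²≈ε = proj₂ ρ₁-order2

  ρ₂²≈ε : ρ₂ ∙ ρ₂ ≈ ε
  ρ₂²≈ε = proj₂ ρ₂-order2

  σ₁-InvertedBy-ρ₀ : InvertedBy σ₁ ρ₀
  σ₁-InvertedBy-ρ₀ = involutions-∙-InvertedByˡ ρ₀²≈ε ρ₁²≈ε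

  σ₁-InvertedBy-ρ₁ : InvertedBy σ₁ ρ₁
  σ₁-InvertedBy-ρ₁ = involutions-∙-InvertedByʳ ρ₀²≈ε ρ₁²≈ε

  σ₂-InvertedBy-ρ₁ : InvertedBy σ₂ ρ₁
  σ₂-InvertedBy-ρ₁ = involutions-∙-InvertedByˡ ρ₁²≈ε ρ₂²≈ε

  σ₂-InvertedBy-ρ₂ : InvertedBy σ₂ ρ₂
  σ₂-InvertedBy-ρ₂ = involutions-∙-InvertedByʳ ρ₁²≈ε ρ₂²≈ε

  σ₁∙ρ₁≈ρ₀ : σ₁ ∙ ρ₁ ≈ ρ₀
  σ₁∙ρ₁≈ρ₀ = trans (assoc ρ₀ ρ₁ ρ₁) (trans (∙-congˡ ρ₁²≈ε) (identityʳ ρ₀))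

  ρ₁∙σ₂≈ρ₂ : ρ₁ ∙ σ₂ ≈ ρ₂
  ρ₁∙σ₂≈ρ₂ = trans (sym (assoc ρ₁ ρ₁ ρ₂)) (trans (∙-congʳ ρ₁²≈ε) (identityˡ ρ₂))

  σ₁σ₂-involution : (σ₁ ∙ σ₂) ∙ (σ₁ ∙ σ₂) ≈ ε
  σ₁σ₂-involution = trans (∙-cong σ₁σ₂≈ρ₀ρ₂ σ₁σ₂≈ρ₀ρ₂) ρ₀ρ₂-sq
    where
    σ₁σ₂≈ρ₀ρ₂ : σ₁ ∙ σ₂ ≈ ρ₀ ∙ ρ₂
    σ₁σ₂≈ρ₀ρ₂ = trans (sym (assoc σ₁ ρ₁ ρ₂)) (∙-congʳ σ₁∙ρ₁≈ρ₀)

  CyclicNormal-intro : ∀ {x} → Normalises ρ₀ x → Normalises ρ₁ x → Normalises ρ₂ x → CyclicNormal x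
  CyclicNormal-intro n₀ n₁ n₂ g k with generated g
  ... | w , w≈g with Normalises-evalWord n₀ n₁ n₂ w k
  ... | m , conj≈ = m , trans (conj-congˡ _ (sym w≈g)) conj≈

  module _ (i j : ℤ) where
    P Q : Carrier
    P = σ₁ ^ i
    Q = σ₂ ^ j

    part-a : σ₂ ⁻¹ ∙ σ₁ ≈ (σ₁ ^ i) ∙ (σ₂ ^ j) →
      InvertedBy (σ₁ ^ (i + 1ℤ)) ρ₀ × InvertedBy (σ₁ ^ (i + 1ℤ)) ρ₁ × InvertedBy (σ₁ ^ (i + 1ℤ)) ρ₂
      × InvertedBy (σ₂ ^ (j - 1ℤ)) ρ₀ × InvertedBy (σ₂ ^ (j - 1ℤ)) ρ₁ × InvertedBy (σ₂ ^ (j - 1ℤ)) ρ₂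
      × CyclicNormal (σ₁ ^ (i + 1ℤ)) × CyclicNormal (σ₂ ^ (j - 1ℤ))
    part-a σ₂⁻¹σ₁≈PQ =
      x-ρ₀ , x-ρ₁ , x-ρ₂ , y-ρ₀ , y-ρ₁ , y-ρ₂
      , CyclicNormal-intro (InvertedBy⇒Normalises x-ρ₀) (InvertedBy⇒Normalises x-ρ₁) (InvertedBy⇒Normalises x-ρ₂)
      , CyclicNormal-intro (InvertedBy⇒Normalises y-ρ₀) (InvertedBy⇒Normalises y-ρ₁) (InvertedBy⇒Normalises y-ρ₂)
      where
      σ₁σ₂⁻¹≈QP : σ₁ ∙ σ₂ ⁻¹ ≈ Q ∙ P
      σ₁σ₂⁻¹≈QP = InvertedBy-factorisation-swap (InvertedBy-⁻¹ σ₂-InvertedBy-ρ₁) σ₁-InvertedBy-ρ₁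
                  (InvertedBy-^ i σ₁-InvertedBy-ρ₁) (InvertedBy-^ j σ₂-InvertedBy-ρ₁) σ₂⁻¹σ₁≈PQ
      x y : Carrier
      x = σ₁ ^ (i + 1ℤ)
      y = σ₂ ^ (j - 1ℤ)
      x-σ₂⁻¹ : CommutesWith x (σ₂ ⁻¹)
      x-σ₂⁻¹ = CommutesWith-respˡ (sym (^-suc σ₁ i))
                 (factorisations⇒CommutesWith σ₂⁻¹σ₁≈PQ σ₁σ₂⁻¹≈QP (^-comm σ₁ i))
      y-σ₁ : CommutesWith y σ₁
      y-σ₁ = CommutesWith-respˡ (sym (^-pred σ₂ j))
               (factorisations⇒CommutesWith σ₁σ₂⁻¹≈QP σ₂⁻¹σ₁≈PQ (CommutesWith-⁻¹ (^-comm σ₂ j)))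
      x-ρ₀ : InvertedBy x ρ₀
      x-ρ₀ = InvertedBy-^ (i + 1ℤ) σ₁-InvertedBy-ρ₀
      x-ρ₁ : InvertedBy x ρ₁
      x-ρ₁ = InvertedBy-^ (i + 1ℤ) σ₁-InvertedBy-ρ₁
      x-ρ₂ : InvertedBy x ρ₂
      x-ρ₂ = InvertedBy-respʳ ρ₁∙σ₂≈ρ₂ (InvertedBy-∙-CommutesWith x-ρ₁
               (CommutesWith-respʳ (⁻¹-involutive σ₂) (CommutesWith-⁻¹ x-σ₂⁻¹)))
      y-ρ₁ : InvertedBy y ρ₁
      y-ρ₁ = InvertedBy-^ (j - 1ℤ) σ₂-InvertedBy-ρ₁
      y-ρ₂ : InvertedBy y ρ₂
      y-ρ₂ = InvertedBy-^ (j - 1ℤ) σ₂-InvertedBy-ρ₂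
      y-ρ₀ : InvertedBy y ρ₀
      y-ρ₀ = InvertedBy-respʳ σ₁∙ρ₁≈ρ₀ (CommutesWith-∙-InvertedBy y-σ₁ y-ρ₁)

    part-b : σ₂ ⁻¹ ∙ σ₁ ≈ ((σ₁ ^ i) ∙ ρ₁) ∙ (σ₂ ^ j) →
      InvertedBy (σ₁ ^ (i - (1ℤ + 1ℤ))) ρ₀ × InvertedBy (σ₁ ^ (i - (1ℤ + 1ℤ))) ρ₁
      × InvertedBy (σ₁ ^ (i - (1ℤ + 1ℤ))) σ₂ × CommutesWith (σ₁ ^ (i - (1ℤ + 1ℤ))) ρ₂
      × InvertedBy (σ₂ ^ (j + (1ℤ + 1ℤ))) ρ₁ × InvertedBy (σ₂ ^ (j + (1ℤ + 1ℤ))) ρ₂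
      × InvertedBy (σ₂ ^ (j + (1ℤ + 1ℤ))) σ₁ × CommutesWith (σ₂ ^ (j + (1ℤ + 1ℤ))) ρ₀
      × CyclicNormal (σ₁ ^ (i - (1ℤ + 1ℤ))) × CyclicNormal (σ₂ ^ (j + (1ℤ + 1ℤ)))
    part-b σ₂⁻¹σ₁≈Pρ₁Q =
      z-ρ₀ , z-ρ₁ , z-σ₂ , z-ρ₂ , w-ρ₁ , w-ρ₂ , w-σ₁ , w-ρ₀
      , CyclicNormal-intro (InvertedBy⇒Normalises z-ρ₀) (InvertedBy⇒Normalises z-ρ₁) (CommutesWith⇒Normalises z-ρ₂)
      , CyclicNormal-intro (CommutesWith⇒Normalises w-ρ₀) (InvertedBy⇒Normalises w-ρ₁) (InvertedBy⇒Normalises w-ρ₂)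
      where
      σ₁⁻¹σ₂≈Q⁻¹ρ₁P⁻¹ : σ₁ ⁻¹ ∙ σ₂ ≈ (σ₂ ⁻¹) ^ j ∙ (ρ₁ ∙ P ⁻¹)
      σ₁⁻¹σ₂≈Q⁻¹ρ₁P⁻¹ = begin
        σ₁ ⁻¹ ∙ σ₂                  ≈⟨ ⁻¹-anti-homo-\\ σ₂ σ₁ ⟨
        (σ₂ ⁻¹ ∙ σ₁) ⁻¹             ≈⟨ ⁻¹-cong σ₂⁻¹σ₁≈Pρ₁Q ⟩
        ((P ∙ ρ₁) ∙ Q) ⁻¹           ≈⟨ ⁻¹-anti-homo-∙ _ _ ⟩
        Q ⁻¹ ∙ (P ∙ ρ₁) ⁻¹          ≈⟨ ∙-cong (sym (⁻¹-^ σ₂ j)) (⁻¹-anti-homo-∙ _ _) ⟩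
        (σ₂ ⁻¹) ^ j ∙ (ρ₁ ⁻¹ ∙ P ⁻¹) ≈⟨ ∙-congˡ (∙-congʳ (involution⁻¹≈ ρ₁²≈ε)) ⟩
        (σ₂ ⁻¹) ^ j ∙ (ρ₁ ∙ P ⁻¹)   ∎
      z w : Carrier
      z = σ₁ ^ (i - (1ℤ + 1ℤ))
      w = σ₂ ^ (j + (1ℤ + 1ℤ))
      z-σ₂ : InvertedBy z σ₂
      z-σ₂ = InvertedBy-respˡ (sym (^-pred² σ₁ i))
               (twisted-factorisation⇒InvertedBy (∙-involution⇒sts≈t⁻¹ σ₁σ₂-involution)
                 (CommutesWith-⁻¹ (^-comm σ₁ i))
                 (involution-∙-InvertedBy ρ₁²≈ε (InvertedBy-^ j σ₂-InvertedBy-ρ₁))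
                 (trans σ₂⁻¹σ₁≈Pρ₁Q (assoc _ _ _)))
      w⁻¹-σ₁ : InvertedBy (w ⁻¹) σ₁
      w⁻¹-σ₁ = InvertedBy-respˡ (trans (sym (^-suc² (σ₂ ⁻¹) j)) (⁻¹-^ σ₂ (j + (1ℤ + 1ℤ))))
                 (twisted-factorisation⇒InvertedBy (∙-involution⇒tst≈s⁻¹ σ₁σ₂-involution)
                   (^-comm (σ₂ ⁻¹) j)
                   (involution-∙-InvertedBy ρ₁²≈ε (InvertedBy-⁻¹ (InvertedBy-^ i σ₁-InvertedBy-ρ₁)))
                   σ₁⁻¹σ₂≈Q⁻¹ρ₁P⁻¹)
      w-σ₁ : InvertedBy w σ₁
      w-σ₁ = InvertedBy-respˡ (⁻¹-involutive w) (InvertedBy-⁻¹ w⁻¹-σ₁)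
      z-ρ₀ : InvertedBy z ρ₀
      z-ρ₀ = InvertedBy-^ (i - (1ℤ + 1ℤ)) σ₁-InvertedBy-ρ₀
      z-ρ₁ : InvertedBy z ρ₁
      z-ρ₁ = InvertedBy-^ (i - (1ℤ + 1ℤ)) σ₁-InvertedBy-ρ₁
      z-ρ₂ : CommutesWith z ρ₂
      z-ρ₂ = CommutesWith-respʳ ρ₁∙σ₂≈ρ₂ (InvertedBy-∙-InvertedBy z-ρ₁ z-σ₂)
      w-ρ₁ : InvertedBy w ρ₁
      w-ρ₁ = InvertedBy-^ (j + (1ℤ + 1ℤ)) σ₂-InvertedBy-ρ₁
      w-ρ₂ : InvertedBy w ρ₂
      w-ρ₂ = InvertedBy-^ (j + (1ℤ + 1ℤ)) σ₂-InvertedBy-ρ₂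
      w-ρ₀ : CommutesWith w ρ₀
      w-ρ₀ = CommutesWith-respʳ σ₁∙ρ₁≈ρ₀ (InvertedBy-∙-InvertedBy w-σ₁ w-ρ₁)

proposition3p2 : {c ℓ : Level} (G : Group c ℓ) (Γ : SGGI3 G) (i j : ℤ) →
    let open Group G hiding (_-_) in let open GroupNotions G in let open SGGI3 Γ in
    ((σ₂ ⁻¹ ∙ σ₁ ≈ (σ₁ ^ i) ∙ (σ₂ ^ j)) →
      (InvertedBy (σ₁ ^ (i + 1ℤ)) ρ₀ × InvertedBy (σ₁ ^ (i + 1ℤ)) ρ₁ × InvertedBy (σ₁ ^ (i + 1ℤ)) ρ₂
       × InvertedBy (σ₂ ^ (j - 1ℤ)) ρ₀ × InvertedBy (σ₂ ^ (j - 1ℤ)) ρ₁ × InvertedBy (σ₂ ^ (j - 1ℤ)) ρ₂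
       × CyclicNormal (σ₁ ^ (i + 1ℤ)) × CyclicNormal (σ₂ ^ (j - 1ℤ))))
    × ((σ₂ ⁻¹ ∙ σ₁ ≈ ((σ₁ ^ i) ∙ ρ₁) ∙ (σ₂ ^ j)) →
      (InvertedBy (σ₁ ^ (i - (1ℤ + 1ℤ))) ρ₀ × InvertedBy (σ₁ ^ (i - (1ℤ + 1ℤ))) ρ₁
       × InvertedBy (σ₁ ^ (i - (1ℤ + 1ℤ))) σ₂ × CommutesWith (σ₁ ^ (i - (1ℤ + 1ℤ))) ρ₂
       × InvertedBy (σ₂ ^ (j + (1ℤ + 1ℤ))) ρ₁ × InvertedBy (σ₂ ^ (j + (1ℤ + 1ℤ))) ρ₂
       × InvertedBy (σ₂ ^ (j + (1ℤ + 1ℤ))) σ₁ × CommutesWith (σ₂ ^ (j + (1ℤ + 1ℤ))) ρ₀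
       × CyclicNormal (σ₁ ^ (i - (1ℤ + 1ℤ))) × CyclicNormal (σ₂ ^ (j + (1ℤ + 1ℤ)))))
proposition3p2 G Γ i j = part-a i j , part-b i j
  where open SGGI3-Properties Γ
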